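{- Let $c \in \mathbb{Z}$ and $f_c(x) = x^2 + c$. If $-c$ is not a square in $\mathbb{Z}$, then $f_c^2(x) = (x^2+c)^2 + c$ is irreducible over $\mathbb{Q}$. If $-c$ is a square in $\mathbb{Z}$ and $c \neq 0, -1$, then writing $c = -b^2$ with $b \in \mathbb{Z}$, one has $f_c^2(x) = (x^2 - (b^2 - b))(x^2 - (b^2+b))$, where each of the two quadratic factors is irreducible over $\mathbb{Q}$. -}

module Defs where

open import Data.Nat using (ℕ; zero; suc)
open import Data.Integer using (ℤ)
open import Data.List using (List; []; _∷_)
open import Data.Product using (Σ; _×_)
open import Data.Sum using (_⊎_)
open import Relation.Nullary using (¬_)
open import Relation.Binary.PropositionalEquality using (_≡_)
open import Data.Rational using (ℚ; 0ℚ; 1ℚ; _/_) renaming (_+_ to _+ℚ_; _*_ to _*ℚ_)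

-- Univariate polynomials over ℚ, as coefficient lists, constant term first.
-- Trailing zeros are allowed; equality of polynomials is coefficientwise.
Poly : Set
Poly = List ℚ

ι : ℤ → ℚ
ι z = z / 1

coeff : Poly → ℕ → ℚ
coeff []      _       = 0ℚ
coeff (a ∷ p) zero    = a
coeff (a ∷ p) (suc n) = coeff p n

infix 4 _≈ₚ_
_≈ₚ_ : Poly → Poly → Set
p ≈ₚ q = ∀ n → coeff p n ≡ coeff q n

infixl 6 _+ₚ_
_+ₚ_ : Poly → Poly → Poly
[]      +ₚ q       = q
(a ∷ p) +ₚ []      = a ∷ p
(a ∷ p) +ₚ (b ∷ q) = (a +ℚ b) ∷ (p +ₚ q)

scale : ℚ → Poly → Poly
scale a []      = []
scale a (b ∷ p) = (a *ℚ b) ∷ scale a p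

infixl 7 _*ₚ_
_*ₚ_ : Poly → Poly → Poly
[]      *ₚ q = []
(a ∷ p) *ₚ q = scale a q +ₚ (0ℚ ∷ (p *ₚ q))

oneₚ : Poly
oneₚ = 1ℚ ∷ []

_∘ₚ_ : Poly → Poly → Poly
[]      ∘ₚ q = []
(a ∷ p) ∘ₚ q = (a ∷ []) +ₚ (q *ₚ (p ∘ₚ q))

iterate : ℕ → Poly → Poly
iterate zero    p = 0ℚ ∷ 1ℚ ∷ []
iterate (suc n) p = p ∘ₚ iterate n p

IsZero : Poly → Set
IsZero p = ∀ n → coeff p n ≡ 0ℚ

IsUnit : Poly → Set
IsUnit p = Σ Poly (λ q → p *ₚ q ≈ₚ oneₚ)

Irreducible : Poly → Set
Irreducible p = ¬ IsZero p × ¬ IsUnit p ×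
  (∀ g h → p ≈ₚ g *ₚ h → IsUnit g ⊎ IsUnit h)

f : ℤ → Poly
f c = ι c ∷ 0ℚ ∷ 1ℚ ∷ []

x²- : ℤ → Poly
x²- a = ι (Data.Integer.- a) ∷ 0ℚ ∷ 1ℚ ∷ []

{-# OPTIONS --safe #-}
-- f_c²(x) = (x² + c)² + c = x⁴ + 2c x² + c + c² has degree 4. A linear factor over ℚ gives a
-- rational root r, and then (r² + c)² = -c. Two quadratic factors can be rescaled to monic ones,
-- x² + α₁ x + α₀ and x² - α₁ x + β₀, and comparing coefficients gives either α₁ = 0 and
-- (α₀ - c)² = -c, or α₀ = β₀ and α₀² = c + c². A rational square of an integer is an integer
-- square, and c + c² lies strictly between consecutive squares unless c ∈ {0, -1}, where -c is a
-- square anyway; so every factorisation forces -c to be a square. For c = -b² the factorisation is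
-- a polynomial identity, and x² - (b² ∓ b) is irreducible because b² ∓ b = d + d² with d = ∓b.
module Submission where

open import Data.Empty using (⊥; ⊥-elim)
open import Data.Integer as ℤ using (ℤ; _*_; _-_; _+_; -_; +_; -[1+_]; +[1+_]; ∣_∣; 0ℤ; 1ℤ; -1ℤ)
import Data.Integer.Properties as ℤ
import Data.Integer.Tactic.RingSolver as ℤ-Solver
open import Data.List using ([]; _∷_; length)
open import Data.Nat as ℕ using (ℕ; zero; suc; z≤n; s≤s)
import Data.Nat.Properties as ℕ
open import Data.Nat.Coprimality using (Coprime; coprime?; coprime-divisor)
import Data.Nat.Coprimality as Coprime
open import Data.Nat.Divisibility using (_∣_; divides; ∣-refl)
import Data.Nat.Tactic.RingSolver as ℕ-Solver
open import Data.Product using (Σ; _×_; _,_; proj₁; proj₂)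
open import Data.Rational as ℚ using (ℚ; mkℚ; 0ℚ; 1ℚ; toℚᵘ)
  renaming (_+_ to _+ℚ_; _*_ to _*ℚ_; -_ to -ℚ_)
import Data.Rational.Properties as ℚ
open import Data.Rational.Unnormalised as ℚᵘ using (mkℚᵘ; *≡*) renaming (_≃_ to _≃ᵘ_)
import Data.Rational.Unnormalised.Properties as ℚᵘ
open import Data.Sum using (_⊎_; inj₁; inj₂; [_,_]′)
open import Level using (0ℓ)
open import Relation.Binary.PropositionalEquality
open import Relation.Binary.Bundles using (Setoid)
open import Relation.Binary.Definitions using (tri<; tri≈; tri>)
import Relation.Binary.Reasoning.Setoid as SetoidReasoning
open import Function using (_∘_; id)
open import Algebra.Properties.Group ℚ.+-0-group using (inverseˡ-unique; inverseʳ-unique; x≈y⇒x∙y⁻¹≈ε)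
open import Relation.Nullary using (¬_; yes; no)
open import Relation.Nullary.Decidable using (dec⇒maybe; recompute)
open import Tactic.RingSolver using (solve-∀)
open import Tactic.RingSolver.Core.AlmostCommutativeRing using (AlmostCommutativeRing; fromCommutativeRing)

open import Defs

ℚ-ring : AlmostCommutativeRing 0ℓ 0ℓ
ℚ-ring = fromCommutativeRing ℚ.+-*-commutativeRing (λ q → dec⇒maybe (0ℚ ℚ.≟ q))


-- Squares among the pronic numbers c + c²

no-square-between-consecutive-squares : ∀ {u k} → u ℕ.* u ℕ.< k ℕ.* k → k ℕ.* k ℕ.< suc u ℕ.* suc u → ⊥
no-square-between-consecutive-squares {u} {k} u²<k² k²<[1+u]² with k ℕ.≤? u
... | yes k≤u = ℕ.<⇒≱ u²<k² (ℕ.*-mono-≤ k≤u k≤u)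
... | no  k≰u = ℕ.<⇒≱ k²<[1+u]² (ℕ.*-mono-≤ (ℕ.≰⇒> k≰u) (ℕ.≰⇒> k≰u))

positive-pronic-nonsquare : ∀ n k → +[1+ n ] + +[1+ n ] * +[1+ n ] ≢ k * k
positive-pronic-nonsquare n k eq = no-square-between-consecutive-squares {u} {∣ k ∣}
  (subst (u ℕ.* u ℕ.<_) eqℕ (ℕ.m<n+m (u ℕ.* u) (s≤s z≤n)))
  (subst (ℕ._< suc u ℕ.* suc u) eqℕ
    (ℕ.≤-trans (ℕ.m≤m+n (suc (u ℕ.+ u ℕ.* u)) u) (ℕ.≤-reflexive (sym ([1+u]²≡1+u+u²+u u)))))
  where
  u = suc n
  eqℕ : u ℕ.+ u ℕ.* u ≡ ∣ k ∣ ℕ.* ∣ k ∣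
  eqℕ = trans (cong ∣_∣ eq) (ℤ.abs-* k k)
  [1+u]²≡1+u+u²+u : ∀ u → suc u ℕ.* suc u ≡ suc (u ℕ.+ u ℕ.* u) ℕ.+ u
  [1+u]²≡1+u+u²+u = ℕ-Solver.solve-∀

-- c ↦ -1 - c fixes c + c² and takes -[1+ suc n ] to +[1+ n ].
pronic-reflection : ∀ c → c + c * c ≡ (-1ℤ - c) + (-1ℤ - c) * (-1ℤ - c)
pronic-reflection = ℤ-Solver.solve-∀

pronic-square⇒≡0∨≡-1 : ∀ c k → c + c * c ≡ k * k → c ≡ 0ℤ ⊎ c ≡ -1ℤ
pronic-square⇒≡0∨≡-1 (+ 0)        k _  = inj₁ refl
pronic-square⇒≡0∨≡-1 +[1+ n ]     k eq = ⊥-elim (positive-pronic-nonsquare n k eq)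
pronic-square⇒≡0∨≡-1 -[1+ 0 ]     k _  = inj₂ refl
pronic-square⇒≡0∨≡-1 -[1+ suc n ] k eq = ⊥-elim (positive-pronic-nonsquare n k (trans (pronic-reflection +[1+ n ]) eq))

pronic-square⇒neg-square : ∀ c k → c + c * c ≡ k * k → Σ ℤ λ b → - c ≡ b * b
pronic-square⇒neg-square c k eq with pronic-square⇒≡0∨≡-1 c k eq
... | inj₁ refl = 0ℤ , refl
... | inj₂ refl = 1ℤ , refl

pronic-nonsquare : ∀ {d k} → - (d * d) ≢ 0ℤ → - (d * d) ≢ -1ℤ → d + d * d ≢ k * k
pronic-nonsquare {d} {k} d²≢0 d²≢1 eq with pronic-square⇒≡0∨≡-1 d k eq
... | inj₁ refl = d²≢0 refl
... | inj₂ refl = d²≢1 refl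

b²±b-nonsquare : ∀ b → - (b * b) ≢ 0ℤ → - (b * b) ≢ -1ℤ → ∀ k → b * b - b ≢ k * k × b * b + b ≢ k * k
b²±b-nonsquare b b²≢0 b²≢1 k =
  (λ eq → pronic-nonsquare { - b} {k} (b²≢0 ∘ trans (-b²≡-[-b]² b)) (b²≢1 ∘ trans (-b²≡-[-b]² b)) (trans (b²-b≡pronic b) eq)) ,
  (λ eq → pronic-nonsquare {b} {k} b²≢0 b²≢1 (trans (ℤ.+-comm b (b * b)) eq))
  where
  -b²≡-[-b]² : ∀ b → - (b * b) ≡ - (- b * - b)
  -b²≡-[-b]² = ℤ-Solver.solve-∀
  b²-b≡pronic : ∀ b → - b + - b * - b ≡ b * b - b
  b²-b≡pronic = ℤ-Solver.solve-∀


p*q≡0⇒p≡0∨q≡0 : ∀ p q → p *ℚ q ≡ 0ℚ → p ≡ 0ℚ ⊎ q ≡ 0ℚ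
p*q≡0⇒p≡0∨q≡0 p q pq≡0 with p ℚ.≟ 0ℚ
... | yes p≡0 = inj₁ p≡0
... | no  p≢0 = inj₂ (begin
  q                      ≡⟨ ℚ.*-identityˡ q ⟨
  1ℚ *ℚ q                ≡⟨ cong (_*ℚ q) (ℚ.*-inverseˡ p) ⟨
  ℚ.1/ p *ℚ p *ℚ q       ≡⟨ ℚ.*-assoc (ℚ.1/ p) p q ⟩
  ℚ.1/ p *ℚ (p *ℚ q)     ≡⟨ cong (ℚ.1/ p *ℚ_) pq≡0 ⟩
  ℚ.1/ p *ℚ 0ℚ           ≡⟨ ℚ.*-zeroʳ (ℚ.1/ p) ⟩
  0ℚ                     ∎)
  where
  open ≡-Reasoning
  instance _ = ℚ.≢-nonZero p≢0

p≢0∧p*q≡0⇒q≡0 : ∀ {p q} → p ≢ 0ℚ → p *ℚ q ≡ 0ℚ → q ≡ 0ℚ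
p≢0∧p*q≡0⇒q≡0 {p} {q} p≢0 pq≡0 = [ ⊥-elim ∘ p≢0 , id ]′ (p*q≡0⇒p≡0∨q≡0 p q pq≡0)

p≡0∨q≡0⇒p*q≡0 : ∀ {p q} → p ≡ 0ℚ ⊎ q ≡ 0ℚ → p *ℚ q ≡ 0ℚ
p≡0∨q≡0⇒p*q≡0 {q = q} (inj₁ refl) = ℚ.*-zeroˡ q
p≡0∨q≡0⇒p*q≡0 {p = p} (inj₂ refl) = ℚ.*-zeroʳ p

p+-q≡0⇒p≡q : ∀ p q → p +ℚ -ℚ q ≡ 0ℚ → p ≡ q
p+-q≡0⇒p≡q p q p-q≡0 = begin
  p                    ≡⟨ regroup p q ⟩
  p +ℚ -ℚ q +ℚ q       ≡⟨ cong (_+ℚ q) p-q≡0 ⟩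
  0ℚ +ℚ q              ≡⟨ ℚ.+-identityˡ q ⟩
  q                    ∎
  where
  open ≡-Reasoning
  regroup : ∀ p q → p ≡ p +ℚ -ℚ q +ℚ q
  regroup = solve-∀ ℚ-ring

toℚᵘ-ι : ∀ m → toℚᵘ (ι m) ≃ᵘ mkℚᵘ m 0
toℚᵘ-ι m = ℚ.toℚᵘ-fromℚᵘ (mkℚᵘ m 0)

ι-homo-* : ∀ m n → ι (m * n) ≡ ι m *ℚ ι n
ι-homo-* m n = ℚ.toℚᵘ-injective (begin
  toℚᵘ (ι (m * n))               ≈⟨ toℚᵘ-ι (m * n) ⟩
  mkℚᵘ (m * n) 0                 ≈⟨ ℚᵘ.*-cong (toℚᵘ-ι m) (toℚᵘ-ι n) ⟨
  toℚᵘ (ι m) ℚᵘ.* toℚᵘ (ι n)     ≈⟨ ℚ.toℚᵘ-homo-* (ι m) (ι n) ⟨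
  toℚᵘ (ι m *ℚ ι n)              ∎)
  where open ℚᵘ.≃-Reasoning

ι-homo-+ : ∀ m n → ι (m + n) ≡ ι m +ℚ ι n
ι-homo-+ m n = ℚ.toℚᵘ-injective (begin
  toℚᵘ (ι (m + n))               ≈⟨ toℚᵘ-ι (m + n) ⟩
  mkℚᵘ (m + n) 0                 ≈⟨ *≡* (cong₂ (λ i j → (i + j) * + 1) (ℤ.*-identityʳ m) (ℤ.*-identityʳ n)) ⟨
  mkℚᵘ m 0 ℚᵘ.+ mkℚᵘ n 0         ≈⟨ ℚᵘ.+-cong (toℚᵘ-ι m) (toℚᵘ-ι n) ⟨
  toℚᵘ (ι m) ℚᵘ.+ toℚᵘ (ι n)     ≈⟨ ℚ.toℚᵘ-homo-+ (ι m) (ι n) ⟨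
  toℚᵘ (ι m +ℚ ι n)              ∎)
  where open ℚᵘ.≃-Reasoning

ι-homo‿- : ∀ m → ι (- m) ≡ -ℚ ι m
ι-homo‿- m = ℚ.toℚᵘ-injective (begin
  toℚᵘ (ι (- m))                 ≈⟨ toℚᵘ-ι (- m) ⟩
  mkℚᵘ (- m) 0                   ≈⟨ ℚᵘ.-‿cong (toℚᵘ-ι m) ⟨
  ℚᵘ.- toℚᵘ (ι m)                ≈⟨ ℚ.toℚᵘ-homo‿- (ι m) ⟨
  toℚᵘ (-ℚ ι m)                  ∎)
  where open ℚᵘ.≃-Reasoning

ι-pronic : ∀ c → ι (c + c * c) ≡ ι c +ℚ ι c *ℚ ι c
ι-pronic c = trans (ι-homo-+ c (c * c)) (cong (ι c +ℚ_) (ι-homo-* c c))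

Square : ℚ → Set
Square q = Σ ℚ λ s → s *ℚ s ≡ q

coprime-∣-square⇒≡1 : ∀ {n d} → Coprime n d → d ∣ n ℕ.* n → d ≡ 1
coprime-∣-square⇒≡1 n⊥d d∣n² = n⊥d (coprime-divisor (Coprime.sym n⊥d) d∣n² , ∣-refl)

ι-square⇒square : ∀ m → Square (ι m) → Σ ℤ λ k → m ≡ k * k
ι-square⇒square m (s@(mkℚ n d-1 n⊥d) , s²≡m) = n , m≡n*n
  where
  D = suc d-1

  cross : n * n * + 1 ≡ m * + (D ℕ.* D)
  cross = ℚᵘ.drop-*≡* (ℚᵘ.≃-trans (ℚᵘ.≃-sym (ℚ.toℚᵘ-homo-* s s)) (ℚᵘ.≃-trans (ℚ.toℚᵘ-cong s²≡m) (toℚᵘ-ι m)))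

  D∣n² : D ∣ ∣ n ∣ ℕ.* ∣ n ∣
  D∣n² = divides (∣ m ∣ ℕ.* D) (begin
    ∣ n ∣ ℕ.* ∣ n ∣          ≡⟨ ℤ.abs-* n n ⟨
    ∣ n * n ∣                ≡⟨ cong ∣_∣ (ℤ.*-identityʳ (n * n)) ⟨
    ∣ n * n * + 1 ∣          ≡⟨ cong ∣_∣ cross ⟩
    ∣ m * + (D ℕ.* D) ∣      ≡⟨ ℤ.abs-* m (+ (D ℕ.* D)) ⟩
    ∣ m ∣ ℕ.* (D ℕ.* D)      ≡⟨ ℕ.*-assoc ∣ m ∣ D D ⟨
    ∣ m ∣ ℕ.* D ℕ.* D        ∎)
    where open ≡-Reasoning

  D≡1 : D ≡ 1
  D≡1 = coprime-∣-square⇒≡1 (recompute (coprime? ∣ n ∣ D) n⊥d) D∣n²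

  m≡n*n : m ≡ n * n
  m≡n*n = begin
    m                  ≡⟨ ℤ.*-identityʳ m ⟨
    m * + (1 ℕ.* 1)    ≡⟨ cong (λ d → m * + (d ℕ.* d)) D≡1 ⟨
    m * + (D ℕ.* D)    ≡⟨ cross ⟨
    n * n * + 1        ≡⟨ ℤ.*-identityʳ (n * n) ⟩
    n * n              ∎
    where open ≡-Reasoning


-- Polynomial arithmetic

≈ₚ-setoid : Setoid 0ℓ 0ℓ
≈ₚ-setoid = record
  { Carrier       = Poly
  ; _≈_           = _≈ₚ_
  ; isEquivalence = record
    { refl  = λ _ → refl
    ; sym   = λ p≈q n → sym (p≈q n)
    ; trans = λ p≈q q≈r n → trans (p≈q n) (q≈r n)
    }
  }

module ≈ₚ-Reasoning = SetoidReasoning ≈ₚ-setoid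

coeff-+ₚ : ∀ p q n → coeff (p +ₚ q) n ≡ coeff p n +ℚ coeff q n
coeff-+ₚ []      q       n       = sym (ℚ.+-identityˡ (coeff q n))
coeff-+ₚ (a ∷ p) []      n       = sym (ℚ.+-identityʳ (coeff (a ∷ p) n))
coeff-+ₚ (a ∷ p) (b ∷ q) zero    = refl
coeff-+ₚ (a ∷ p) (b ∷ q) (suc n) = coeff-+ₚ p q n

coeff-scale : ∀ a p n → coeff (scale a p) n ≡ a *ℚ coeff p n
coeff-scale a []      n       = sym (ℚ.*-zeroʳ a)
coeff-scale a (b ∷ p) zero    = refl
coeff-scale a (b ∷ p) (suc n) = coeff-scale a p n

cauchy : (ℕ → ℚ) → (ℕ → ℚ) → ℕ → ℚ
cauchy a b zero    = a 0 *ℚ b 0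
cauchy a b (suc n) = a 0 *ℚ b (suc n) +ℚ cauchy (a ∘ suc) b n

cauchy-cong : ∀ {a a′ b b′} → a ≗ a′ → b ≗ b′ → cauchy a b ≗ cauchy a′ b′
cauchy-cong a≗a′ b≗b′ zero    = cong₂ _*ℚ_ (a≗a′ 0) (b≗b′ 0)
cauchy-cong a≗a′ b≗b′ (suc n) =
  cong₂ _+ℚ_ (cong₂ _*ℚ_ (a≗a′ 0) (b≗b′ (suc n))) (cauchy-cong (a≗a′ ∘ suc) b≗b′ n)

cauchy-zeroˡ : ∀ {a} b → (∀ i → a i ≡ 0ℚ) → ∀ n → cauchy a b n ≡ 0ℚ
cauchy-zeroˡ b a≡0 zero    rewrite a≡0 0 = ℚ.*-zeroˡ (b 0)
cauchy-zeroˡ b a≡0 (suc n) rewrite a≡0 0 | cauchy-zeroˡ b (a≡0 ∘ suc) n =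
  trans (ℚ.+-identityʳ _) (ℚ.*-zeroˡ (b (suc n)))

cauchy-zeroʳ : ∀ a {b} → (∀ j → b j ≡ 0ℚ) → ∀ n → cauchy a b n ≡ 0ℚ
cauchy-zeroʳ a b≡0 zero    rewrite b≡0 0 = ℚ.*-zeroʳ (a 0)
cauchy-zeroʳ a b≡0 (suc n) rewrite b≡0 (suc n) | cauchy-zeroʳ (a ∘ suc) b≡0 n =
  trans (ℚ.+-identityʳ _) (ℚ.*-zeroʳ (a 0))

coeff-*ₚ : ∀ p q n → coeff (p *ₚ q) n ≡ cauchy (coeff p) (coeff q) n
coeff-*ₚ []      q n       = sym (cauchy-zeroˡ (coeff q) (λ _ → refl) n)
coeff-*ₚ (a ∷ p) q zero    = begin
  coeff (scale a q +ₚ (0ℚ ∷ p *ₚ q)) 0  ≡⟨ coeff-+ₚ (scale a q) (0ℚ ∷ p *ₚ q) 0 ⟩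
  coeff (scale a q) 0 +ℚ 0ℚ             ≡⟨ ℚ.+-identityʳ _ ⟩
  coeff (scale a q) 0                   ≡⟨ coeff-scale a q 0 ⟩
  a *ℚ coeff q 0                        ∎
  where open ≡-Reasoning
coeff-*ₚ (a ∷ p) q (suc n) = begin
  coeff (scale a q +ₚ (0ℚ ∷ p *ₚ q)) (suc n)     ≡⟨ coeff-+ₚ (scale a q) (0ℚ ∷ p *ₚ q) (suc n) ⟩
  coeff (scale a q) (suc n) +ℚ coeff (p *ₚ q) n  ≡⟨ cong₂ _+ℚ_ (coeff-scale a q (suc n)) (coeff-*ₚ p q n) ⟩
  a *ℚ coeff q (suc n) +ℚ cauchy (coeff p) (coeff q) n ∎
  where open ≡-Reasoning

+ₚ-cong : ∀ {p p′ q q′} → p ≈ₚ p′ → q ≈ₚ q′ → p +ₚ q ≈ₚ p′ +ₚ q′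
+ₚ-cong {p} {p′} {q} {q′} p≈p′ q≈q′ n = begin
  coeff (p +ₚ q) n         ≡⟨ coeff-+ₚ p q n ⟩
  coeff p n +ℚ coeff q n   ≡⟨ cong₂ _+ℚ_ (p≈p′ n) (q≈q′ n) ⟩
  coeff p′ n +ℚ coeff q′ n ≡⟨ coeff-+ₚ p′ q′ n ⟨
  coeff (p′ +ₚ q′) n       ∎
  where open ≡-Reasoning

*ₚ-cong : ∀ {p p′ q q′} → p ≈ₚ p′ → q ≈ₚ q′ → p *ₚ q ≈ₚ p′ *ₚ q′
*ₚ-cong {p} {p′} {q} {q′} p≈p′ q≈q′ n = begin
  coeff (p *ₚ q) n                 ≡⟨ coeff-*ₚ p q n ⟩
  cauchy (coeff p) (coeff q) n     ≡⟨ cauchy-cong p≈p′ q≈q′ n ⟩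
  cauchy (coeff p′) (coeff q′) n   ≡⟨ coeff-*ₚ p′ q′ n ⟨
  coeff (p′ *ₚ q′) n               ∎
  where open ≡-Reasoning

*ₚ-zeroˡ : ∀ p q → IsZero p → IsZero (p *ₚ q)
*ₚ-zeroˡ p q p≡0 n = trans (coeff-*ₚ p q n) (cauchy-zeroˡ (coeff q) p≡0 n)

*ₚ-zeroʳ : ∀ p q → IsZero q → IsZero (p *ₚ q)
*ₚ-zeroʳ p q q≡0 n = trans (coeff-*ₚ p q n) (cauchy-zeroʳ (coeff p) q≡0 n)

cauchy-identityʳ : ∀ a n → cauchy a (coeff oneₚ) n ≡ a n
cauchy-identityʳ a zero    = ℚ.*-identityʳ (a 0)
cauchy-identityʳ a (suc n) rewrite cauchy-identityʳ (a ∘ suc) n | ℚ.*-zeroʳ (a 0) = ℚ.+-identityˡ (a (suc n))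

*ₚ-identityʳ : ∀ p → p *ₚ oneₚ ≈ₚ p
*ₚ-identityʳ p n = trans (coeff-*ₚ p oneₚ n) (cauchy-identityʳ (coeff p) n)

+ₚ-identityˡ : ∀ z p → IsZero z → z +ₚ p ≈ₚ p
+ₚ-identityˡ z p z≡0 n rewrite coeff-+ₚ z p n | z≡0 n = ℚ.+-identityˡ (coeff p n)

+ₚ-identityʳ : ∀ p z → IsZero z → p +ₚ z ≈ₚ p
+ₚ-identityʳ p z z≡0 n rewrite coeff-+ₚ p z n | z≡0 n = ℚ.+-identityʳ (coeff p n)

coeff-beyond-length : ∀ p i → length p ℕ.≤ i → coeff p i ≡ 0ℚ
coeff-beyond-length []      i       _         = refl
coeff-beyond-length (a ∷ p) (suc i) (s≤s p≤i) = coeff-beyond-length p i p≤i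


-- Degree and irreducibility

VanishesAbove : ℕ → (ℕ → ℚ) → Set
VanishesAbove k a = ∀ i → k ℕ.< i → a i ≡ 0ℚ

record HasDegree (p : Poly) (k : ℕ) : Set where
  constructor has-degree
  field
    leading≢0 : coeff p k ≢ 0ℚ
    vanishes  : VanishesAbove k (coeff p)

a*0+0≡0 : ∀ a {x y} → x ≡ 0ℚ → y ≡ 0ℚ → a *ℚ x +ℚ y ≡ 0ℚ
a*0+0≡0 a refl refl = trans (ℚ.+-identityʳ (a *ℚ 0ℚ)) (ℚ.*-zeroʳ a)

cauchy-above : ∀ k m {a b} → VanishesAbove k a → VanishesAbove m b → VanishesAbove (k ℕ.+ m) (cauchy a b)
cauchy-above zero m {a} {b} a↑ b↑ (suc n) m<1+n =
  a*0+0≡0 (a 0) (b↑ (suc n) m<1+n) (cauchy-zeroˡ b (λ i → a↑ (suc i) (s≤s z≤n)) n)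
cauchy-above (suc k) m {a} {b} a↑ b↑ (suc n) k+m<n@(s≤s k+m<n-1) =
  a*0+0≡0 (a 0) (b↑ (suc n) (ℕ.≤-<-trans (ℕ.m≤n+m m (suc k)) k+m<n))
    (cauchy-above k m (λ i k<i → a↑ (suc i) (s≤s k<i)) b↑ n k+m<n-1)

cauchy-top : ∀ k m {a b} → VanishesAbove k a → VanishesAbove m b → cauchy a b (k ℕ.+ m) ≡ a k *ℚ b m
cauchy-top zero    zero    a↑ b↑ = refl
cauchy-top zero    (suc m) {a} {b} a↑ b↑ =
  trans (cong (a 0 *ℚ b (suc m) +ℚ_) (cauchy-zeroˡ b (λ i → a↑ (suc i) (s≤s z≤n)) m)) (ℚ.+-identityʳ _)
cauchy-top (suc k) m {a} {b} a↑ b↑ = begin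
  a 0 *ℚ b (suc (k ℕ.+ m)) +ℚ cauchy (a ∘ suc) b (k ℕ.+ m)
    ≡⟨ cong₂ _+ℚ_ (cong (a 0 *ℚ_) (b↑ _ (s≤s (ℕ.m≤n+m m k)))) (cauchy-top k m (λ i k<i → a↑ (suc i) (s≤s k<i)) b↑) ⟩
  a 0 *ℚ 0ℚ +ℚ a (suc k) *ℚ b m
    ≡⟨ cong (_+ℚ a (suc k) *ℚ b m) (ℚ.*-zeroʳ (a 0)) ⟩
  0ℚ +ℚ a (suc k) *ℚ b m
    ≡⟨ ℚ.+-identityˡ _ ⟩
  a (suc k) *ℚ b m ∎
  where open ≡-Reasoning

HasDegree-*ₚ : ∀ {p q k m} → HasDegree p k → HasDegree q m → HasDegree (p *ₚ q) (k ℕ.+ m)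
HasDegree-*ₚ {p} {q} {k} {m} (has-degree pₖ≢0 p↑) (has-degree qₘ≢0 q↑) = has-degree top≢0 λ i k+m<i →
  trans (coeff-*ₚ p q i) (cauchy-above k m p↑ q↑ i k+m<i)
  where
  top≢0 : coeff (p *ₚ q) (k ℕ.+ m) ≢ 0ℚ
  top≢0 top≡0 = [ pₖ≢0 , qₘ≢0 ]′ (p*q≡0⇒p≡0∨q≡0 (coeff p k) (coeff q m)
    (trans (sym (cauchy-top k m p↑ q↑)) (trans (sym (coeff-*ₚ p q (k ℕ.+ m))) top≡0)))

HasDegree-unique : ∀ {p k m} → HasDegree p k → HasDegree p m → k ≡ m
HasDegree-unique {k = k} {m} (has-degree pₖ≢0 p↑k) (has-degree pₘ≢0 p↑m) with ℕ.<-cmp k m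
... | tri< k<m _ _ = ⊥-elim (pₘ≢0 (p↑k m k<m))
... | tri≈ _ k≡m _ = k≡m
... | tri> _ _ m<k = ⊥-elim (pₖ≢0 (p↑m k m<k))

HasDegree-resp-≈ₚ : ∀ {p q k} → p ≈ₚ q → HasDegree p k → HasDegree q k
HasDegree-resp-≈ₚ {k = k} p≈q (has-degree pₖ≢0 p↑) =
  has-degree (λ qₖ≡0 → pₖ≢0 (trans (p≈q k) qₖ≡0)) λ i k<i → trans (sym (p≈q i)) (p↑ i k<i)

zero-or-degree : ∀ p → IsZero p ⊎ Σ ℕ (HasDegree p)
zero-or-degree []      = inj₁ λ _ → refl
zero-or-degree (a ∷ p) with zero-or-degree p
... | inj₂ (k , has-degree pₖ≢0 p↑) = inj₂ (suc k , has-degree pₖ≢0 λ { (suc i) (s≤s k<i) → p↑ i k<i })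
... | inj₁ p≡0 with a ℚ.≟ 0ℚ
...   | yes a≡0 = inj₁ λ { zero → a≡0 ; (suc n) → p≡0 n }
...   | no  a≢0 = inj₂ (0 , has-degree a≢0 λ { (suc i) _ → p≡0 i })

HasDegree-oneₚ : HasDegree oneₚ 0
HasDegree-oneₚ = has-degree (λ ()) (coeff-beyond-length oneₚ)

HasDegree-0⇒IsUnit : ∀ {p} → HasDegree p 0 → IsUnit p
HasDegree-0⇒IsUnit {[]}    (has-degree p₀≢0 _) = ⊥-elim (p₀≢0 refl)
HasDegree-0⇒IsUnit {a ∷ p} (has-degree a≢0 p↑) = (ℚ.1/ a ∷ []) , p*a⁻¹≈1
  where
  instance _ = ℚ.≢-nonZero a≢0
  p*a⁻¹≈1 : (a ∷ p) *ₚ (ℚ.1/ a ∷ []) ≈ₚ oneₚ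
  p*a⁻¹≈1 zero    = trans (coeff-*ₚ (a ∷ p) (ℚ.1/ a ∷ []) 0) (ℚ.*-inverseʳ a)
  p*a⁻¹≈1 (suc n) = trans (coeff-*ₚ (a ∷ p) (ℚ.1/ a ∷ []) (suc n))
    (cauchy-above 0 0 p↑ (λ { (suc i) _ → refl }) (suc n) (s≤s z≤n))

positive-degree⇒¬IsUnit : ∀ {p n} → HasDegree p (suc n) → ¬ IsUnit p
positive-degree⇒¬IsUnit {p} deg (q , pq≈1) with zero-or-degree q
... | inj₁ q≡0 = ℚ.1≢0 (trans (sym (pq≈1 0)) (*ₚ-zeroʳ p q q≡0 0))
... | inj₂ (m , degq) with HasDegree-unique (HasDegree-resp-≈ₚ {p *ₚ q} pq≈1 (HasDegree-*ₚ deg degq)) HasDegree-oneₚ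
...   | ()

factor-degrees : ∀ {p g h k m n} → p ≈ₚ g *ₚ h →
  HasDegree g (suc k) → HasDegree h (suc m) → HasDegree p (suc (suc n)) → k ℕ.+ m ≡ n
factor-degrees {p} {g} {h} {k} {m} p≈gh dg dh dp =
  ℕ.suc-injective (trans (sym (ℕ.+-suc k m))
    (ℕ.suc-injective (HasDegree-unique (HasDegree-resp-≈ₚ {g *ₚ h} {p} (sym ∘ p≈gh) (HasDegree-*ₚ dg dh)) dp)))

NoPositiveDegreeFactorisation : Poly → Set
NoPositiveDegreeFactorisation p =
  ∀ g h {k m} → p ≈ₚ g *ₚ h → HasDegree g (suc k) → HasDegree h (suc m) → ⊥

positive-degree-unfactorisable⇒irreducible :
  ∀ {p n} → HasDegree p (suc n) → NoPositiveDegreeFactorisation p → Irreducible p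
positive-degree-unfactorisable⇒irreducible {p} {n} deg nofac = p≉0 , positive-degree⇒¬IsUnit deg , factor-unit
  where
  p≉0 : ¬ IsZero p
  p≉0 p≡0 = HasDegree.leading≢0 deg (p≡0 (suc n))

  factor-unit : ∀ g h → p ≈ₚ g *ₚ h → IsUnit g ⊎ IsUnit h
  factor-unit g h p≈gh with zero-or-degree g | zero-or-degree h
  ... | inj₁ g≡0          | _                  = ⊥-elim (p≉0 λ i → trans (p≈gh i) (*ₚ-zeroˡ g h g≡0 i))
  ... | inj₂ _            | inj₁ h≡0           = ⊥-elim (p≉0 λ i → trans (p≈gh i) (*ₚ-zeroʳ g h h≡0 i))
  ... | inj₂ (zero , dg)  | inj₂ _             = inj₁ (HasDegree-0⇒IsUnit dg)
  ... | inj₂ (suc _ , _)  | inj₂ (zero , dh)   = inj₂ (HasDegree-0⇒IsUnit dh)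
  ... | inj₂ (suc _ , dg) | inj₂ (suc _ , dh)  = ⊥-elim (nofac g h p≈gh dg dh)

Irreducible-resp-≈ₚ : ∀ {p q} → p ≈ₚ q → Irreducible p → Irreducible q
Irreducible-resp-≈ₚ {p} {q} p≈q (p≉0 , p-non-unit , p-factors) =
  (λ q≡0 → p≉0 λ n → trans (p≈q n) (q≡0 n)) ,
  (λ (r , qr≈1) → p-non-unit (r , λ n → trans (*ₚ-cong {p} {q} {r} {r} p≈q (λ _ → refl) n) (qr≈1 n))) ,
  (λ g h q≈gh → p-factors g h λ n → trans (p≈q n) (q≈gh n))


-- Evaluation and rational roots

eval : Poly → ℚ → ℚ
eval []      x = 0ℚ
eval (a ∷ p) x = a +ℚ x *ℚ eval p x

eval-zero : ∀ p x → IsZero p → eval p x ≡ 0ℚ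
eval-zero []      x p≡0 = refl
eval-zero (a ∷ p) x p≡0 rewrite p≡0 0 | eval-zero p x (p≡0 ∘ suc) =
  trans (ℚ.+-identityˡ (x *ℚ 0ℚ)) (ℚ.*-zeroʳ x)

eval-resp-≈ₚ : ∀ p q x → p ≈ₚ q → eval p x ≡ eval q x
eval-resp-≈ₚ []      q       x p≈q = sym (eval-zero q x (sym ∘ p≈q))
eval-resp-≈ₚ (a ∷ p) []      x p≈q = eval-zero (a ∷ p) x p≈q
eval-resp-≈ₚ (a ∷ p) (b ∷ q) x p≈q =
  cong₂ (λ c y → c +ℚ x *ℚ y) (p≈q 0) (eval-resp-≈ₚ p q x (p≈q ∘ suc))

eval-+ₚ : ∀ p q x → eval (p +ₚ q) x ≡ eval p x +ℚ eval q x
eval-+ₚ []      q       x = sym (ℚ.+-identityˡ (eval q x))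
eval-+ₚ (a ∷ p) []      x = sym (ℚ.+-identityʳ (eval (a ∷ p) x))
eval-+ₚ (a ∷ p) (b ∷ q) x rewrite eval-+ₚ p q x = regroup a b x (eval p x) (eval q x)
  where
  regroup : ∀ a b x u v → a +ℚ b +ℚ x *ℚ (u +ℚ v) ≡ a +ℚ x *ℚ u +ℚ (b +ℚ x *ℚ v)
  regroup = solve-∀ ℚ-ring

eval-scale : ∀ a p x → eval (scale a p) x ≡ a *ℚ eval p x
eval-scale a []      x = sym (ℚ.*-zeroʳ a)
eval-scale a (b ∷ p) x rewrite eval-scale a p x = factor a b x (eval p x)
  where
  factor : ∀ a b x u → a *ℚ b +ℚ x *ℚ (a *ℚ u) ≡ a *ℚ (b +ℚ x *ℚ u)
  factor = solve-∀ ℚ-ring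

eval-*ₚ : ∀ p q x → eval (p *ₚ q) x ≡ eval p x *ℚ eval q x
eval-*ₚ []      q x = sym (ℚ.*-zeroˡ (eval q x))
eval-*ₚ (a ∷ p) q x
  rewrite eval-+ₚ (scale a q) (0ℚ ∷ p *ₚ q) x | eval-scale a q x | eval-*ₚ p q x =
  factor a x (eval p x) (eval q x)
  where
  factor : ∀ a x u v → a *ℚ v +ℚ (0ℚ +ℚ x *ℚ (u *ℚ v)) ≡ (a +ℚ x *ℚ u) *ℚ v
  factor = solve-∀ ℚ-ring

linear-root : ∀ {g} → HasDegree g 1 → Σ ℚ λ r → eval g r ≡ 0ℚ
linear-root {[]}              (has-degree g₁≢0 _)  = ⊥-elim (g₁≢0 refl)
linear-root {a₀ ∷ []}         (has-degree g₁≢0 _)  = ⊥-elim (g₁≢0 refl)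
linear-root {a₀ ∷ a₁ ∷ g} (has-degree a₁≢0 g↑) = r , (begin
  a₀ +ℚ r *ℚ (a₁ +ℚ r *ℚ eval g r)      ≡⟨ cong (λ y → a₀ +ℚ r *ℚ (a₁ +ℚ r *ℚ y)) (eval-zero g r λ i → g↑ (2 ℕ.+ i) (s≤s (s≤s z≤n))) ⟩
  a₀ +ℚ r *ℚ (a₁ +ℚ r *ℚ 0ℚ)            ≡⟨ expand a₀ a₁ (ℚ.1/ a₁) ⟩
  a₀ *ℚ (1ℚ +ℚ -ℚ (a₁ *ℚ ℚ.1/ a₁))      ≡⟨ cong (λ y → a₀ *ℚ (1ℚ +ℚ -ℚ y)) (ℚ.*-inverseʳ a₁) ⟩
  a₀ *ℚ (1ℚ +ℚ -ℚ 1ℚ)                   ≡⟨ ℚ.*-zeroʳ a₀ ⟩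
  0ℚ                                    ∎)
  where
  open ≡-Reasoning
  instance _ = ℚ.≢-nonZero a₁≢0
  r = -ℚ (a₀ *ℚ ℚ.1/ a₁)
  expand : ∀ a₀ a₁ i → a₀ +ℚ -ℚ (a₀ *ℚ i) *ℚ (a₁ +ℚ -ℚ (a₀ *ℚ i) *ℚ 0ℚ) ≡ a₀ *ℚ (1ℚ +ℚ -ℚ (a₁ *ℚ i))
  expand = solve-∀ ℚ-ring

factor-root : ∀ p g h r → p ≈ₚ g *ₚ h → eval g r ≡ 0ℚ ⊎ eval h r ≡ 0ℚ → eval p r ≡ 0ℚ
factor-root p g h r p≈gh root = begin
  eval p r                   ≡⟨ eval-resp-≈ₚ p (g *ₚ h) r p≈gh ⟩
  eval (g *ₚ h) r            ≡⟨ eval-*ₚ g h r ⟩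
  eval g r *ℚ eval h r       ≡⟨ p≡0∨q≡0⇒p*q≡0 root ⟩
  0ℚ                         ∎
  where open ≡-Reasoning

linear-factor⇒root : ∀ p g h → p ≈ₚ g *ₚ h → HasDegree g 1 ⊎ HasDegree h 1 → Σ ℚ λ r → eval p r ≡ 0ℚ
linear-factor⇒root p g h p≈gh (inj₁ g-linear) =
  let r , gr≡0 = linear-root g-linear in r , factor-root p g h r p≈gh (inj₁ gr≡0)
linear-factor⇒root p g h p≈gh (inj₂ h-linear) =
  let r , hr≡0 = linear-root h-linear in r , factor-root p g h r p≈gh (inj₂ hr≡0)


x²+ : ℚ → Poly
x²+ A = A ∷ 0ℚ ∷ 1ℚ ∷ []

HasDegree-x²+ : ∀ A → HasDegree (x²+ A) 2
HasDegree-x²+ A = has-degree (λ ()) (coeff-beyond-length (x²+ A))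

x²+-root⇒square : ∀ A r → eval (x²+ A) r ≡ 0ℚ → Square (-ℚ A)
x²+-root⇒square A r root = r , inverseˡ-unique (r *ℚ r) A (trans (horner A r) root)
  where
  horner : ∀ A r → r *ℚ r +ℚ A ≡ A +ℚ r *ℚ (0ℚ +ℚ r *ℚ (1ℚ +ℚ r *ℚ 0ℚ))
  horner = solve-∀ ℚ-ring

x²+-irreducible : ∀ A → ¬ Square (-ℚ A) → Irreducible (x²+ A)
x²+-irreducible A nonsquare = positive-degree-unfactorisable⇒irreducible (HasDegree-x²+ A) no-factors
  where
  no-factors : NoPositiveDegreeFactorisation (x²+ A)
  no-factors g h {k} p≈gh dg dh with ℕ.m+n≡0⇒m≡0 k (factor-degrees p≈gh dg dh (HasDegree-x²+ A))
  ... | refl = let r , root = linear-factor⇒root (x²+ A) g h p≈gh (inj₁ dg) in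
               nonsquare (x²+-root⇒square A r root)

quadratic-*ₚ : ∀ a₀ a₁ a₂ b₀ b₁ b₂ → (a₀ ∷ a₁ ∷ a₂ ∷ []) *ₚ (b₀ ∷ b₁ ∷ b₂ ∷ []) ≈ₚ
  (a₀ *ℚ b₀ ∷ a₀ *ℚ b₁ +ℚ a₁ *ℚ b₀ ∷ a₀ *ℚ b₂ +ℚ (a₁ *ℚ b₁ +ℚ a₂ *ℚ b₀) ∷ a₁ *ℚ b₂ +ℚ a₂ *ℚ b₁ ∷ a₂ *ℚ b₂ ∷ [])
quadratic-*ₚ a₀ a₁ a₂ b₀ b₁ b₂ 0 = ℚ.+-identityʳ (a₀ *ℚ b₀)
quadratic-*ₚ a₀ a₁ a₂ b₀ b₁ b₂ 1 = cong (a₀ *ℚ b₁ +ℚ_) (ℚ.+-identityʳ (a₁ *ℚ b₀))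
quadratic-*ₚ a₀ a₁ a₂ b₀ b₁ b₂ 2 = cong (λ x → a₀ *ℚ b₂ +ℚ (a₁ *ℚ b₁ +ℚ x)) (ℚ.+-identityʳ (a₂ *ℚ b₀))
quadratic-*ₚ a₀ a₁ a₂ b₀ b₁ b₂ (suc (suc (suc i))) = refl

-- The composite is a list of length 7 whose entries beyond degree 2 are closed zeros.
x²+-∘ₚ-x : ∀ A → x²+ A ∘ₚ (0ℚ ∷ 1ℚ ∷ []) ≈ₚ x²+ A
x²+-∘ₚ-x A 0 = ℚ.+-identityʳ A
x²+-∘ₚ-x A 1 = refl
x²+-∘ₚ-x A 2 = refl
x²+-∘ₚ-x A 3 = refl
x²+-∘ₚ-x A 4 = refl
x²+-∘ₚ-x A 5 = refl
x²+-∘ₚ-x A 6 = refl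
x²+-∘ₚ-x A (suc (suc (suc (suc (suc (suc (suc i))))))) = refl

x²+-∘ₚ : ∀ A q → x²+ A ∘ₚ q ≈ₚ (A ∷ []) +ₚ q *ₚ q
x²+-∘ₚ A q = +ₚ-cong {A ∷ []} {A ∷ []} {q *ₚ inner} {q *ₚ q} (λ _ → refl) (*ₚ-cong {q} {q} {inner} {q} (λ _ → refl) inner≈q)
  where
  inner = (0ℚ ∷ []) +ₚ q *ₚ (oneₚ +ₚ q *ₚ [])
  inner≈q : inner ≈ₚ q
  inner≈q = begin
    inner                    ≈⟨ +ₚ-identityˡ (0ℚ ∷ []) (q *ₚ (oneₚ +ₚ q *ₚ [])) (λ { zero → refl ; (suc _) → refl }) ⟩
    q *ₚ (oneₚ +ₚ q *ₚ [])   ≈⟨ *ₚ-cong {q} {q} {oneₚ +ₚ q *ₚ []} {oneₚ} (λ _ → refl) (+ₚ-identityʳ oneₚ (q *ₚ []) (*ₚ-zeroʳ q [] λ _ → refl)) ⟩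
    q *ₚ oneₚ                ≈⟨ *ₚ-identityʳ q ⟩
    q                        ∎
    where open ≈ₚ-Reasoning


-- The quartic x⁴ + 2C x² + C + C² = (x² + C)² + C

biquadratic : ℚ → ℚ → Poly
biquadratic s t = t ∷ 0ℚ ∷ s ∷ 0ℚ ∷ 1ℚ ∷ []

HasDegree-biquadratic : ∀ s t → HasDegree (biquadratic s t) 4
HasDegree-biquadratic s t = has-degree (λ ()) (coeff-beyond-length (biquadratic s t))

x²+-*ₚ : ∀ A B → x²+ A *ₚ x²+ B ≈ₚ biquadratic (A +ℚ B) (A *ℚ B)
x²+-*ₚ A B 0 = quadratic-*ₚ A 0ℚ 1ℚ B 0ℚ 1ℚ 0
x²+-*ₚ A B 1 = trans (quadratic-*ₚ A 0ℚ 1ℚ B 0ℚ 1ℚ 1) (x-coeff A B)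
  where
  x-coeff : ∀ A B → A *ℚ 0ℚ +ℚ 0ℚ *ℚ B ≡ 0ℚ
  x-coeff = solve-∀ ℚ-ring
x²+-*ₚ A B 2 = trans (quadratic-*ₚ A 0ℚ 1ℚ B 0ℚ 1ℚ 2) (x²-coeff A B)
  where
  x²-coeff : ∀ A B → A *ℚ 1ℚ +ℚ (0ℚ *ℚ 0ℚ +ℚ 1ℚ *ℚ B) ≡ A +ℚ B
  x²-coeff = solve-∀ ℚ-ring
x²+-*ₚ A B (suc (suc (suc i))) = quadratic-*ₚ A 0ℚ 1ℚ B 0ℚ 1ℚ (3 ℕ.+ i)

iterate-2-x²+ : ∀ A → iterate 2 (x²+ A) ≈ₚ biquadratic (A +ℚ A) (A +ℚ A *ℚ A)
iterate-2-x²+ A = begin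
  x²+ A ∘ₚ q                                ≈⟨ x²+-∘ₚ A q ⟩
  (A ∷ []) +ₚ q *ₚ q                        ≈⟨ +ₚ-cong {A ∷ []} {A ∷ []} {q *ₚ q} {x²+ A *ₚ x²+ A} (λ _ → refl) (*ₚ-cong {q} {x²+ A} {q} {x²+ A} (x²+-∘ₚ-x A) (x²+-∘ₚ-x A)) ⟩
  (A ∷ []) +ₚ x²+ A *ₚ x²+ A                ≈⟨ +ₚ-cong {A ∷ []} {A ∷ []} {x²+ A *ₚ x²+ A} {biquadratic (A +ℚ A) (A *ℚ A)} (λ _ → refl) (x²+-*ₚ A A) ⟩
  (A ∷ []) +ₚ biquadratic (A +ℚ A) (A *ℚ A) ≡⟨⟩
  biquadratic (A +ℚ A) (A +ℚ A *ℚ A)        ∎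
  where
  open ≈ₚ-Reasoning
  q = x²+ A ∘ₚ (0ℚ ∷ 1ℚ ∷ [])

≈ₚ-quadratic : ∀ g → VanishesAbove 2 (coeff g) → g ≈ₚ coeff g 0 ∷ coeff g 1 ∷ coeff g 2 ∷ []
≈ₚ-quadratic g g↑ 0 = refl
≈ₚ-quadratic g g↑ 1 = refl
≈ₚ-quadratic g g↑ 2 = refl
≈ₚ-quadratic g g↑ (suc (suc (suc i))) = g↑ (3 ℕ.+ i) (s≤s (s≤s (s≤s z≤n)))

-- The hypotheses compare coefficients in x⁴ + 2C x² + C + C² = (x² + α₁ x + α₀)(x² + β₁ x + β₀).
monic-quadratic-factors : ∀ C α₀ α₁ β₀ β₁ →
  α₀ *ℚ β₀ ≡ C +ℚ C *ℚ C → α₀ *ℚ β₁ +ℚ α₁ *ℚ β₀ ≡ 0ℚ →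
  α₀ +ℚ (α₁ *ℚ β₁ +ℚ β₀) ≡ C +ℚ C → α₁ +ℚ β₁ ≡ 0ℚ →
  Square (-ℚ C) ⊎ Square (C +ℚ C *ℚ C)
monic-quadratic-factors C α₀ α₁ β₀ β₁ e₀ e₁ e₂ e₃ with α₁ ℚ.≟ 0ℚ
... | yes refl = inj₁ (α₀ +ℚ -ℚ C , (begin
  (α₀ +ℚ -ℚ C) *ℚ (α₀ +ℚ -ℚ C)
    ≡⟨ complete-square α₀ β₀ β₁ C ⟩
  C *ℚ C +ℚ -ℚ (α₀ *ℚ β₀) +ℚ α₀ *ℚ (α₀ +ℚ (0ℚ *ℚ β₁ +ℚ β₀) +ℚ -ℚ (C +ℚ C))
    ≡⟨ cong₂ (λ x y → C *ℚ C +ℚ -ℚ x +ℚ α₀ *ℚ y) e₀ (x≈y⇒x∙y⁻¹≈ε e₂) ⟩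
  C *ℚ C +ℚ -ℚ (C +ℚ C *ℚ C) +ℚ α₀ *ℚ 0ℚ
    ≡⟨ cancel C α₀ ⟩
  -ℚ C ∎))
  where
  open ≡-Reasoning
  complete-square : ∀ α₀ β₀ β₁ C → (α₀ +ℚ -ℚ C) *ℚ (α₀ +ℚ -ℚ C) ≡
    C *ℚ C +ℚ -ℚ (α₀ *ℚ β₀) +ℚ α₀ *ℚ (α₀ +ℚ (0ℚ *ℚ β₁ +ℚ β₀) +ℚ -ℚ (C +ℚ C))
  complete-square = solve-∀ ℚ-ring
  cancel : ∀ C α₀ → C *ℚ C +ℚ -ℚ (C +ℚ C *ℚ C) +ℚ α₀ *ℚ 0ℚ ≡ -ℚ C
  cancel = solve-∀ ℚ-ring
... | no α₁≢0 = inj₂ (α₀ , (begin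
  α₀ *ℚ α₀   ≡⟨ cong (α₀ *ℚ_) β₀≡α₀ ⟨
  α₀ *ℚ β₀   ≡⟨ e₀ ⟩
  C +ℚ C *ℚ C ∎))
  where
  open ≡-Reasoning
  regroup : ∀ α₀ α₁ β₀ → α₁ *ℚ (β₀ +ℚ -ℚ α₀) ≡ α₀ *ℚ -ℚ α₁ +ℚ α₁ *ℚ β₀
  regroup = solve-∀ ℚ-ring
  α₁[β₀-α₀]≡0 : α₁ *ℚ (β₀ +ℚ -ℚ α₀) ≡ 0ℚ
  α₁[β₀-α₀]≡0 = begin
    α₁ *ℚ (β₀ +ℚ -ℚ α₀)        ≡⟨ regroup α₀ α₁ β₀ ⟩
    α₀ *ℚ -ℚ α₁ +ℚ α₁ *ℚ β₀    ≡⟨ cong (λ y → α₀ *ℚ y +ℚ α₁ *ℚ β₀) (inverseʳ-unique α₁ β₁ e₃) ⟨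
    α₀ *ℚ β₁ +ℚ α₁ *ℚ β₀       ≡⟨ e₁ ⟩
    0ℚ                          ∎
  β₀≡α₀ : β₀ ≡ α₀
  β₀≡α₀ = p+-q≡0⇒p≡q β₀ α₀ (p≢0∧p*q≡0⇒q≡0 α₁≢0 α₁[β₀-α₀]≡0)

-- Since a₂ b₂ = 1, the rescaled factors b₂ g and a₂ h are monic, with the coefficients α, β below.
biquadratic-quadratic-factors : ∀ C g h → biquadratic (C +ℚ C) (C +ℚ C *ℚ C) ≈ₚ g *ₚ h →
  HasDegree g 2 → HasDegree h 2 → Square (-ℚ C) ⊎ Square (C +ℚ C *ℚ C)
biquadratic-quadratic-factors C g h P≈gh (has-degree _ g↑) (has-degree _ h↑) =
  monic-quadratic-factors C (a₀ *ℚ b₂) (a₁ *ℚ b₂) (a₂ *ℚ b₀) (a₂ *ℚ b₁)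
    (rescale (normalise₀ a₀ a₂ b₀ b₂) (sym (coefficient 0)))
    (rescale (normalise₁ a₀ a₁ a₂ b₀ b₁ b₂) (sym (coefficient 1)))
    x²-coefficient
    (sym (coefficient 3))
  where
  open ≡-Reasoning
  a₀ = coeff g 0 ; a₁ = coeff g 1 ; a₂ = coeff g 2
  b₀ = coeff h 0 ; b₁ = coeff h 1 ; b₂ = coeff h 2

  coefficient : biquadratic (C +ℚ C) (C +ℚ C *ℚ C) ≈ₚ
    (a₀ *ℚ b₀ ∷ a₀ *ℚ b₁ +ℚ a₁ *ℚ b₀ ∷ a₀ *ℚ b₂ +ℚ (a₁ *ℚ b₁ +ℚ a₂ *ℚ b₀) ∷ a₁ *ℚ b₂ +ℚ a₂ *ℚ b₁ ∷ a₂ *ℚ b₂ ∷ [])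
  coefficient n = begin
    coeff (biquadratic (C +ℚ C) (C +ℚ C *ℚ C)) n  ≡⟨ P≈gh n ⟩
    coeff (g *ₚ h) n                              ≡⟨ *ₚ-cong {g} {a₀ ∷ a₁ ∷ a₂ ∷ []} {h} {b₀ ∷ b₁ ∷ b₂ ∷ []}
                                                       (≈ₚ-quadratic g g↑) (≈ₚ-quadratic h h↑) n ⟩
    coeff ((a₀ ∷ a₁ ∷ a₂ ∷ []) *ₚ (b₀ ∷ b₁ ∷ b₂ ∷ [])) n ≡⟨ quadratic-*ₚ a₀ a₁ a₂ b₀ b₁ b₂ n ⟩
    _                                             ∎

  rescale : ∀ {x y z} → x ≡ y *ℚ (a₂ *ℚ b₂) → y ≡ z → x ≡ z
  rescale {x} {y} {z} x≡y*a₂b₂ y≡z = begin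
    x                   ≡⟨ x≡y*a₂b₂ ⟩
    y *ℚ (a₂ *ℚ b₂)     ≡⟨ cong₂ _*ℚ_ y≡z (sym (coefficient 4)) ⟩
    z *ℚ 1ℚ             ≡⟨ ℚ.*-identityʳ z ⟩
    z                   ∎

  normalise₀ : ∀ a₀ a₂ b₀ b₂ → a₀ *ℚ b₂ *ℚ (a₂ *ℚ b₀) ≡ a₀ *ℚ b₀ *ℚ (a₂ *ℚ b₂)
  normalise₀ = solve-∀ ℚ-ring
  normalise₁ : ∀ a₀ a₁ a₂ b₀ b₁ b₂ →
    a₀ *ℚ b₂ *ℚ (a₂ *ℚ b₁) +ℚ a₁ *ℚ b₂ *ℚ (a₂ *ℚ b₀) ≡ (a₀ *ℚ b₁ +ℚ a₁ *ℚ b₀) *ℚ (a₂ *ℚ b₂)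
  normalise₁ = solve-∀ ℚ-ring
  normalise₂ : ∀ a₀ a₁ a₂ b₀ b₁ b₂ →
    a₀ *ℚ b₂ +ℚ (a₁ *ℚ b₂ *ℚ (a₂ *ℚ b₁) +ℚ a₂ *ℚ b₀) ≡ a₀ *ℚ b₂ +ℚ (a₁ *ℚ b₁ *ℚ (a₂ *ℚ b₂) +ℚ a₂ *ℚ b₀)
  normalise₂ = solve-∀ ℚ-ring

  x²-coefficient : a₀ *ℚ b₂ +ℚ (a₁ *ℚ b₂ *ℚ (a₂ *ℚ b₁) +ℚ a₂ *ℚ b₀) ≡ C +ℚ C
  x²-coefficient = begin
    a₀ *ℚ b₂ +ℚ (a₁ *ℚ b₂ *ℚ (a₂ *ℚ b₁) +ℚ a₂ *ℚ b₀)  ≡⟨ normalise₂ a₀ a₁ a₂ b₀ b₁ b₂ ⟩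
    a₀ *ℚ b₂ +ℚ (a₁ *ℚ b₁ *ℚ (a₂ *ℚ b₂) +ℚ a₂ *ℚ b₀)  ≡⟨ cong (λ u → a₀ *ℚ b₂ +ℚ (u +ℚ a₂ *ℚ b₀)) (rescale {y = a₁ *ℚ b₁} refl refl) ⟩
    a₀ *ℚ b₂ +ℚ (a₁ *ℚ b₁ +ℚ a₂ *ℚ b₀)              ≡⟨ coefficient 2 ⟨
    C +ℚ C                                          ∎

biquadratic-root⇒square : ∀ C r → eval (biquadratic (C +ℚ C) (C +ℚ C *ℚ C)) r ≡ 0ℚ → Square (-ℚ C)
biquadratic-root⇒square C r root = r *ℚ r +ℚ C , inverseˡ-unique _ C (trans (horner C r) root)
  where
  horner : ∀ C r → (r *ℚ r +ℚ C) *ℚ (r *ℚ r +ℚ C) +ℚ C ≡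
    C +ℚ C *ℚ C +ℚ r *ℚ (0ℚ +ℚ r *ℚ (C +ℚ C +ℚ r *ℚ (0ℚ +ℚ r *ℚ (1ℚ +ℚ r *ℚ 0ℚ))))
  horner = solve-∀ ℚ-ring

degree-split : ∀ k m → k ℕ.+ m ≡ 2 → k ≡ 0 ⊎ m ≡ 0 ⊎ (k ≡ 1 × m ≡ 1)
degree-split zero             _ _    = inj₁ refl
degree-split (suc zero)       _ refl = inj₂ (inj₂ (refl , refl))
degree-split (suc (suc zero)) _ refl = inj₂ (inj₁ refl)

biquadratic-irreducible : ∀ C → ¬ Square (-ℚ C) → ¬ Square (C +ℚ C *ℚ C) →
  Irreducible (biquadratic (C +ℚ C) (C +ℚ C *ℚ C))
biquadratic-irreducible C ¬□-C ¬□C+C² = positive-degree-unfactorisable⇒irreducible degree no-factors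
  where
  P = biquadratic (C +ℚ C) (C +ℚ C *ℚ C)
  degree : HasDegree P 4
  degree = HasDegree-biquadratic (C +ℚ C) (C +ℚ C *ℚ C)

  linear-factor : ∀ g h → P ≈ₚ g *ₚ h → HasDegree g 1 ⊎ HasDegree h 1 → ⊥
  linear-factor g h P≈gh linear = let r , root = linear-factor⇒root P g h P≈gh linear in
    ¬□-C (biquadratic-root⇒square C r root)

  no-factors : NoPositiveDegreeFactorisation P
  no-factors g h {k} {m} P≈gh dg dh with degree-split k m (factor-degrees P≈gh dg dh degree)
  ... | inj₁ refl                 = linear-factor g h P≈gh (inj₁ dg)
  ... | inj₂ (inj₁ refl)          = linear-factor g h P≈gh (inj₂ dh)
  ... | inj₂ (inj₂ (refl , refl)) = [ ¬□-C , ¬□C+C² ]′ (biquadratic-quadratic-factors C g h P≈gh dg dh)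


-- Integer coefficients

x²-‿irreducible : ∀ a → (∀ k → a ≢ k * k) → Irreducible (x²- a)
x²-‿irreducible a nonsquare = x²+-irreducible (ι (- a)) λ □ →
  let k , a≡k² = ι-square⇒square a (subst Square -ι[-a]≡ιa □) in nonsquare k a≡k²
  where
  -ι[-a]≡ιa : -ℚ ι (- a) ≡ ι a
  -ι[-a]≡ιa = trans (sym (ι-homo‿- (- a))) (cong ι (ℤ.neg-involutive a))

iterate-2-f-irreducible : ∀ c → ¬ Σ ℤ (λ b → - c ≡ b * b) → Irreducible (iterate 2 (f c))
iterate-2-f-irreducible c ¬□-c =
  Irreducible-resp-≈ₚ {biquadratic (C +ℚ C) (C +ℚ C *ℚ C)} {iterate 2 (f c)} (sym ∘ iterate-2-x²+ C)
    (biquadratic-irreducible C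
      (λ □ → ¬□-c (ι-square⇒square (- c) (subst Square (sym (ι-homo‿- c)) □)))
      (λ □ → let k , eq = ι-square⇒square (c + c * c) (subst Square (sym (ι-pronic c)) □) in
             ¬□-c (pronic-square⇒neg-square c k eq)))
  where C = ι c

iterate-2-f-factorises : ∀ b → iterate 2 (f (- (b * b))) ≈ₚ x²- (b * b - b) *ₚ x²- (b * b + b)
iterate-2-f-factorises b = begin
  iterate 2 (f c)                   ≈⟨ iterate-2-x²+ C ⟩
  biquadratic (C +ℚ C) (C +ℚ C *ℚ C) ≡⟨ cong₂ biquadratic sum product ⟩
  biquadratic (A +ℚ B) (A *ℚ B)     ≈⟨ x²+-*ₚ A B ⟨
  x²+ A *ₚ x²+ B                    ∎
  where
  open ≈ₚ-Reasoning
  c = - (b * b)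
  C = ι c
  A = ι (- (b * b - b))
  B = ι (- (b * b + b))
  sumℤ : ∀ b → - (b * b) + - (b * b) ≡ - (b * b - b) + - (b * b + b)
  sumℤ = ℤ-Solver.solve-∀
  productℤ : ∀ b → - (b * b) + - (b * b) * - (b * b) ≡ - (b * b - b) * - (b * b + b)
  productℤ = ℤ-Solver.solve-∀
  sum : C +ℚ C ≡ A +ℚ B
  sum = trans (sym (ι-homo-+ c c)) (trans (cong ι (sumℤ b)) (ι-homo-+ (- (b * b - b)) (- (b * b + b))))
  product : C +ℚ C *ℚ C ≡ A *ℚ B
  product = trans (sym (ι-pronic c)) (trans (cong ι (productℤ b)) (ι-homo-* (- (b * b - b)) (- (b * b + b))))

proposition2p1 : (c : ℤ) →
    ((¬ Σ ℤ (λ b → - c ≡ b * b)) → Irreducible (iterate 2 (f c))) ×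
    (¬ c ≡ + 0 → ¬ c ≡ -[1+ 0 ] → (b : ℤ) → c ≡ - (b * b) →
      (iterate 2 (f c) ≈ₚ x²- (b * b - b) *ₚ x²- (b * b + b)) ×
      Irreducible (x²- (b * b - b)) × Irreducible (x²- (b * b + b)))
proposition2p1 c = iterate-2-f-irreducible c , square-case
  where
  square-case : ¬ c ≡ + 0 → ¬ c ≡ -[1+ 0 ] → (b : ℤ) → c ≡ - (b * b) →
    (iterate 2 (f c) ≈ₚ x²- (b * b - b) *ₚ x²- (b * b + b)) ×
    Irreducible (x²- (b * b - b)) × Irreducible (x²- (b * b + b))
  square-case c≢0 c≢-1 b c≡-b² =
    subst (λ c → iterate 2 (f c) ≈ₚ x²- (b * b - b) *ₚ x²- (b * b + b)) (sym c≡-b²) (iterate-2-f-factorises b) ,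
    x²-‿irreducible (b * b - b) (proj₁ ∘ nonsquare) ,
    x²-‿irreducible (b * b + b) (proj₂ ∘ nonsquare)
    where
    nonsquare = b²±b-nonsquare b (c≢0 ∘ trans c≡-b²) (c≢-1 ∘ trans c≡-b²)
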